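{- Let $k\ge 3$ and let $D$ be a super-orientation of $\overline{C_{2k+1}}$ with vertices labeled $x_0,\ldots,x_{2k}$ so that the complement of the underlying graph of $D$ is the cycle $(x_0,x_1,\ldots,x_{2k},x_0)$. Let $D'$ be the digraph obtained from $D$ by deleting the vertices $x_{2k-1}$ and $x_{2k}$ and the arc(s) between $x_0$ and $x_{2k-2}$ (so $D'$ is a super-orientation of $\overline{C_{2k-1}}$, the complement of the cycle $(x_0,\ldots,x_{2k-2},x_0)$). If $D'$ has a path partition orthogonal to $\{x_0,x_{2k-2}\}$, then $D$ has a path partition orthogonal to $\{x_0,x_{2k}\}$.
   Context: A super-orientation of a graph $G$ is a digraph obtained by replacing each edge $uv$ of $G$ by the arc $(u,v)$, the arc $(v,u)$, or both. A path means a directed path (sequence of distinct vertices, each with an arc to its successor). A path partition of a digraph is a collection of vertex-disjoint paths covering all vertices. A stable set $S$ and a path partition $\mathcal{P}$ are orthogonal if every path of $\mathcal{P}$ contains exactly one vertex of $S$. -}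

module Defs where

open import Data.Nat using (ℕ; zero; suc; _+_; _*_; _∸_; _≤_; _≡ᵇ_)
open import Data.Nat.Properties using (*-monoʳ-≤; +-monoˡ-≤; m∸n≤m)
open import Data.Fin using (Fin; toℕ; inject≤)
open import Data.Bool using (Bool; true; false; T; _∧_; _∨_; not; if_then_else_)
open import Data.List using (List; []; _∷_; concat)
open import Data.List.Relation.Unary.All using (All)
open import Data.List.Relation.Unary.Unique.Propositional using (Unique)
open import Data.List.Membership.Propositional using (_∈_)
open import Data.Product using (_×_)
open import Data.Sum using (_⊎_)
open import Relation.Binary.PropositionalEquality using (_≡_; _≢_)
open import Relation.Nullary using (¬_)

Digraph : ℕ → Set
Digraph n = Fin n → Fin n → Bool

Arc : ∀ {n} → Digraph n → Fin n → Fin n → Set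
Arc D u v = T (D u v)

Graph : ℕ → Set₁
Graph n = Fin n → Fin n → Set

CycleAdj : (n : ℕ) → Fin n → Fin n → Set
CycleAdj n i j =
  (suc (toℕ i) ≡ toℕ j) ⊎ (suc (toℕ j) ≡ toℕ i)
  ⊎ (suc (toℕ i) ≡ n × toℕ j ≡ 0) ⊎ (suc (toℕ j) ≡ n × toℕ i ≡ 0)

ComplementCycle : (n : ℕ) → Graph n
ComplementCycle n i j = (i ≢ j) × ¬ CycleAdj n i j

IsSuperOrientation : ∀ {n} → Graph n → Digraph n → Set
IsSuperOrientation {n} G D =
  (∀ (u v : Fin n) → Arc D u v → G u v) × (∀ (u v : Fin n) → G u v → Arc D u v ⊎ Arc D v u)

data Walk {n : ℕ} (D : Digraph n) : List (Fin n) → Set where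
  single : ∀ v → Walk D (v ∷ [])
  step   : ∀ {u v vs} → Arc D u v → Walk D (v ∷ vs) → Walk D (u ∷ v ∷ vs)

IsPath : ∀ {n} → Digraph n → List (Fin n) → Set
IsPath D p = Walk D p × Unique p

IsPathPartition : ∀ {n} → Digraph n → List (List (Fin n)) → Set
IsPathPartition {n} D ps =
  All (IsPath D) ps × Unique (concat ps) × (∀ (v : Fin n) → v ∈ concat ps)

count : ∀ {n} → (Fin n → Bool) → List (Fin n) → ℕ
count S [] = 0
count S (v ∷ p) = if S v then suc (count S p) else count S p

Orthogonal : ∀ {n} → (Fin n → Bool) → List (List (Fin n)) → Set
Orthogonal S ps = All (λ p → count S p ≡ 1) ps

pairSet : ∀ {n} → ℕ → ℕ → Fin n → Bool
pairSet a b v = (toℕ v ≡ᵇ a) ∨ (toℕ v ≡ᵇ b)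

small≤big : (k : ℕ) → 2 * (k ∸ 1) + 1 ≤ 2 * k + 1
small≤big k = +-monoˡ-≤ 1 (*-monoʳ-≤ 2 (m∸n≤m k 1))

emb : (k : ℕ) → Fin (2 * (k ∸ 1) + 1) → Fin (2 * k + 1)
emb k i = inject≤ i (small≤big k)

-- D' : delete x_{2k-1}, x_{2k} and the arc(s) between x_0 and x_{2k-2}.
reduce : (k : ℕ) → Digraph (2 * k + 1) → Digraph (2 * (k ∸ 1) + 1)
reduce k D u v =
  D (emb k u) (emb k v)
  ∧ not (((toℕ u ≡ᵇ 0) ∧ (toℕ v ≡ᵇ 2 * (k ∸ 1))) ∨ ((toℕ v ≡ᵇ 0) ∧ (toℕ u ≡ᵇ 2 * (k ∸ 1))))

{-# OPTIONS --safe #-}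
-- Orthogonality to {x₀, x_{2k−2}} forces the path partition of D′ to consist of exactly two
-- paths, P₁ through x₀ and P₂ through x_{2k−2}. In the complement of the cycle, x_{2k−1} is
-- adjacent to every vertex except x_{2k−2} and x_{2k}, hence to all of P₁, and x_{2k} to every
-- vertex except x₀ and x_{2k−1}, hence to all of P₂. A vertex adjacent to every vertex of a path
-- can be inserted into it, as in Rédei's theorem for tournaments; inserting x_{2k−1} into P₁ and
-- x_{2k} into P₂ gives a path partition of D orthogonal to {x₀, x_{2k}}.
module Submission where

open import Defs
open import Data.Nat using (ℕ; zero; suc; _+_; _*_; _∸_; _≤_; _<_; _≡ᵇ_; z≤n; s≤s)
open import Data.Nat.Properties
open import Data.Fin using (Fin; toℕ; fromℕ<)
open import Data.Fin.Properties using (toℕ-injective; toℕ<n; toℕ-fromℕ<; toℕ-inject≤; inject≤-injective)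
open import Data.Bool using (Bool; true; false; T; _∨_)
open import Data.Bool.Properties using (T-∧; T-∨; ∨-identityʳ; ¬-not)
open import Data.List using (List; []; _∷_; concat; map; _++_; length; filterᵇ)
open import Data.List.Properties using (concat-map)
open import Data.List.Relation.Unary.All using ([]; _∷_)
import Data.List.Relation.Unary.All as All
open import Data.List.Relation.Unary.All.Properties.Core using (¬Any⇒All¬)
open import Data.List.Relation.Unary.Any using (here; there)
open import Data.List.Relation.Unary.AllPairs using ([]; _∷_)
open import Data.List.Relation.Unary.Unique.Propositional using (Unique)
open import Data.List.Relation.Binary.Disjoint.Propositional using (Disjoint)
import Data.List.Relation.Unary.Unique.Propositional.Properties as Unique
open import Data.List.Membership.Propositional using (_∈_; _∉_)
open import Data.List.Membership.Propositional.Properties using (∈-concat⁺′; ∈-concat⁻′; ∈-map⁺; ∈-map⁻; ∈-++⁺ˡ; ∈-++⁺ʳ)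
open import Data.List.Relation.Binary.Permutation.Propositional using (_↭_; ↭-sym; prep; swap; ↭⇒↭ₛ; module PermutationReasoning)
open import Data.List.Relation.Binary.Permutation.Propositional.Properties using (∈-resp-↭; filter-↭; ↭-length; ++⁺; ++⁺ʳ; shift)
open import Data.List.Relation.Binary.Permutation.Setoid.Properties using (Unique-resp-↭)
open import Data.Product using (Σ; _×_; _,_; proj₁; proj₂; ∃)
open import Data.Sum using (_⊎_; inj₁; inj₂)
open import Function using (_∘_; _⇔_; Equivalence; mk⇔)
open import Relation.Binary.PropositionalEquality
open import Relation.Nullary using (¬_; yes; no; contradiction)
open import Relation.Nullary.Decidable using (T?)

module _ {n : ℕ} (S : Fin n → Bool) where

  count≡length∘filterᵇ : ∀ xs → count S xs ≡ length (filterᵇ S xs)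
  count≡length∘filterᵇ [] = refl
  count≡length∘filterᵇ (v ∷ xs) with S v
  ... | true  = cong suc (count≡length∘filterᵇ xs)
  ... | false = count≡length∘filterᵇ xs

  count-↭ : ∀ {xs ys} → xs ↭ ys → count S xs ≡ count S ys
  count-↭ {xs} {ys} xs↭ys = begin
    count S xs                ≡⟨ count≡length∘filterᵇ xs ⟩
    length (filterᵇ S xs)     ≡⟨ ↭-length (filter-↭ (T? ∘ S) xs↭ys) ⟩
    length (filterᵇ S ys)     ≡⟨ count≡length∘filterᵇ ys ⟨
    count S ys                ∎
    where open ≡-Reasoning

  count-∷-∉ : ∀ {x xs} → ¬ T (S x) → count S (x ∷ xs) ≡ count S xs
  count-∷-∉ {x} ¬Sx with S x
  ... | true  = contradiction _ ¬Sx
  ... | false = refl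

  count-∷-∈ : ∀ {x xs} → T (S x) → count S (x ∷ xs) ≡ suc (count S xs)
  count-∷-∈ {x} Sx with S x
  ... | true = refl

  count≡0⇒¬T : ∀ {v xs} → count S xs ≡ 0 → v ∈ xs → ¬ T (S v)
  count≡0⇒¬T {xs = x ∷ xs} c≡0 (here refl) Sx = 1+n≢0 (trans (sym (count-∷-∈ {xs = xs} Sx)) c≡0)
  count≡0⇒¬T {xs = x ∷ xs} c≡0 (there v∈xs) with S x
  ... | false = count≡0⇒¬T c≡0 v∈xs

  count≡suc⇒∃ : ∀ {xs c} → count S xs ≡ suc c → ∃ λ v → v ∈ xs × T (S v)
  count≡suc⇒∃ {x ∷ xs} c≡suc with S x in Sx≡
  ... | true  = x , here refl , subst T (sym Sx≡) _
  ... | false = let v , v∈xs , Sv = count≡suc⇒∃ c≡suc in v , there v∈xs , Sv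

count-∨ : ∀ {n} (S R : Fin n → Bool) → (∀ v → T (S v) → ¬ T (R v)) → ∀ xs
  → count (λ v → S v ∨ R v) xs ≡ count S xs + count R xs
count-∨ S R disjoint [] = refl
count-∨ S R disjoint (v ∷ xs) with S v in Sv≡ | R v in Rv≡
... | true  | true  = contradiction (subst T (sym Rv≡) _) (disjoint v (subst T (sym Sv≡) _))
... | true  | false = cong suc (count-∨ S R disjoint xs)
... | false | true  = trans (cong suc (count-∨ S R disjoint xs)) (sym (+-suc _ _))
... | false | false = count-∨ S R disjoint xs

count-map : ∀ {m n} {S′ : Fin n → Bool} {S : Fin m → Bool} (e : Fin m → Fin n)
  → (∀ u → S′ (e u) ≡ S u) → ∀ xs → count S′ (map e xs) ≡ count S xs
count-map e S′∘e≡S [] = refl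
count-map {S′ = S′} {S} e S′∘e≡S (u ∷ xs)
  rewrite S′∘e≡S u | count-map {S′ = S′} {S} e S′∘e≡S xs = refl

Indicates : ∀ {n} → (Fin n → Bool) → Fin n → Set
Indicates S s = ∀ v → T (S v) ⇔ v ≡ s

≡ᵇ-indicates : ∀ {n i} {s : Fin n} → toℕ s ≡ i → Indicates (λ v → toℕ v ≡ᵇ i) s
≡ᵇ-indicates {i = i} {s} s≡i v = mk⇔
  (λ t → toℕ-injective (trans (≡ᵇ⇒≡ (toℕ v) i t) (sym s≡i)))
  (λ { refl → ≡⇒≡ᵇ (toℕ s) i s≡i })

≢⇒≡ᵇ≡false : ∀ {m n} → m ≢ n → (m ≡ᵇ n) ≡ false
≢⇒≡ᵇ≡false {m} {n} m≢n = ¬-not (λ m≡ᵇn → m≢n (≡ᵇ⇒≡ m n (subst T (sym m≡ᵇn) _)))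

↭-Unique : ∀ {A : Set} {xs ys : List A} → xs ↭ ys → Unique xs → Unique ys
↭-Unique {A} xs↭ys = Unique-resp-↭ (setoid A) (↭⇒↭ₛ xs↭ys)

Adjacent : ∀ {n} → Digraph n → Fin n → Fin n → Set
Adjacent D x y = Arc D x y ⊎ Arc D y x

module _ {n : ℕ} (D : Digraph n) where

  -- The last component strengthens the induction: q starts with x or with v.
  insert-walk : ∀ x v vs → Walk D (v ∷ vs) → (∀ {y} → y ∈ v ∷ vs → Adjacent D x y)
    → Σ (List (Fin n)) λ q → Walk D q × q ↭ x ∷ v ∷ vs
        × (∀ u → Arc D u x → Arc D u v → Walk D (u ∷ q))
  insert-walk x v vs walk adjacent with T? (D x v) | adjacent (here refl)
  ... | yes x→v | _ = x ∷ v ∷ vs , step x→v walk , _↭_.refl , λ u u→x _ → step u→x (step x→v walk)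
  ... | no x↛v | inj₁ x→v = contradiction x→v x↛v
  insert-walk x v [] walk adjacent | no _ | inj₂ v→x =
    v ∷ x ∷ [] , step v→x (single x) , swap v x _↭_.refl , λ u _ u→v → step u→v (step v→x (single x))
  insert-walk x v (w ∷ ws) (step v→w walk) adjacent | no _ | inj₂ v→x =
    let q , _ , q↭ , prefix = insert-walk x w ws walk (adjacent ∘ there)
        vq-walk = prefix v v→x v→w
    in v ∷ q , vq-walk , _↭_.trans (prep v q↭) (swap v x _↭_.refl) , λ u _ u→v → step u→v vq-walk

  insert-path : ∀ {x p} → IsPath D p → x ∉ p → (∀ {y} → y ∈ p → Adjacent D x y)
    → Σ (List (Fin n)) λ q → IsPath D q × q ↭ x ∷ p
  insert-path {x} {v ∷ vs} (walk , unique) x∉p adjacent =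
    let q , q-walk , q↭ , _ = insert-walk x v vs walk adjacent
    in q , (q-walk , ↭-Unique (↭-sym q↭) (¬Any⇒All¬ _ x∉p ∷ unique)) , q↭

module _ {A : Set} where

  Unique-++⇒disjoint : ∀ xs {ys} {y : A} → Unique (xs ++ ys) → y ∈ xs → y ∉ ys
  Unique-++⇒disjoint (x ∷ xs) (x∉ ∷ _) (here refl) y∈ys = All.lookup x∉ (∈-++⁺ʳ xs y∈ys) refl
  Unique-++⇒disjoint (x ∷ xs) (_ ∷ unique) (there y∈xs) = Unique-++⇒disjoint xs unique y∈xs

  Unique-++⇒Uniqueʳ : ∀ xs {ys : List A} → Unique (xs ++ ys) → Unique ys
  Unique-++⇒Uniqueʳ [] unique = unique
  Unique-++⇒Uniqueʳ (x ∷ xs) (_ ∷ unique) = Unique-++⇒Uniqueʳ xs unique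

  Unique-concat⇒≡ : ∀ {xss : List (List A)} {xs ys y} → Unique (concat xss)
    → xs ∈ xss → ys ∈ xss → y ∈ xs → y ∈ ys → xs ≡ ys
  Unique-concat⇒≡ {zs ∷ _} _ (here refl) (here refl) _ _ = refl
  Unique-concat⇒≡ {zs ∷ _} unique (here refl) (there ys∈) y∈xs y∈ys =
    contradiction (∈-concat⁺′ y∈ys ys∈) (Unique-++⇒disjoint zs unique y∈xs)
  Unique-concat⇒≡ {zs ∷ _} unique (there xs∈) (here refl) y∈xs y∈ys =
    contradiction (∈-concat⁺′ y∈xs xs∈) (Unique-++⇒disjoint zs unique y∈ys)
  Unique-concat⇒≡ {zs ∷ _} unique (there xs∈) (there ys∈) =
    Unique-concat⇒≡ (Unique-++⇒Uniqueʳ zs unique) xs∈ ys∈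

m+n≡1⇒ : ∀ {m n} → m + n ≡ 1 → (m ≡ 1 × n ≡ 0) ⊎ (m ≡ 0 × n ≡ 1)
m+n≡1⇒ {zero} n≡1 = inj₂ (refl , n≡1)
m+n≡1⇒ {suc zero} {zero} _ = inj₁ (refl , refl)

module _ {n : ℕ} {D : Digraph n} {S R : Fin n → Bool} {s t : Fin n}
         (S≡s : Indicates S s) (R≡t : Indicates R t) (s≢t : s ≢ t) where

  two-path-partition : ∀ {ps} → IsPathPartition D ps → Orthogonal (λ v → S v ∨ R v) ps
    → Σ (List (Fin n)) λ p₁ → Σ (List (Fin n)) λ p₂ → IsPathPartition D (p₁ ∷ p₂ ∷ [])
        × (count S p₁ ≡ 1 × count R p₁ ≡ 0) × (count S p₂ ≡ 0 × count R p₂ ≡ 1)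
  two-path-partition {ps} (paths , unique , covered) orthogonal
    with ∈-concat⁻′ ps (covered s) | ∈-concat⁻′ ps (covered t)
  ... | p₁ , s∈p₁ , p₁∈ | p₂ , t∈p₂ , p₂∈ =
    p₁ , p₂ , (All.lookup paths p₁∈ ∷ All.lookup paths p₂∈ ∷ [] , unique₁₂ , covered₁₂) , counts₁ , counts₂
    where
      Ss : T (S s)
      Ss = Equivalence.from (S≡s s) refl
      Rt : T (R t)
      Rt = Equivalence.from (R≡t t) refl

      disjoint : ∀ v → T (S v) → ¬ T (R v)
      disjoint v Sv Rv = s≢t (trans (sym (Equivalence.to (S≡s v) Sv)) (Equivalence.to (R≡t v) Rv))

      counts : ∀ {p} → p ∈ ps → (count S p ≡ 1 × count R p ≡ 0) ⊎ (count S p ≡ 0 × count R p ≡ 1)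
      counts {p} p∈ = m+n≡1⇒ (trans (sym (count-∨ S R disjoint p)) (All.lookup orthogonal p∈))

      counts₁ : count S p₁ ≡ 1 × count R p₁ ≡ 0
      counts₁ with counts p₁∈
      ... | inj₁ c = c
      ... | inj₂ (c , _) = contradiction Ss (count≡0⇒¬T S c s∈p₁)

      counts₂ : count S p₂ ≡ 0 × count R p₂ ≡ 1
      counts₂ with counts p₂∈
      ... | inj₁ (_ , c) = contradiction Rt (count≡0⇒¬T R c t∈p₂)
      ... | inj₂ c = c

      same-path : ∀ {p q y} → p ∈ ps → q ∈ ps → y ∈ p → y ∈ q → p ≡ q
      same-path = Unique-concat⇒≡ unique

      disjoint₁₂ : Disjoint p₁ p₂
      disjoint₁₂ (y∈p₁ , y∈p₂) =
        count≡0⇒¬T R (proj₂ counts₁) (subst (t ∈_) (sym (same-path p₁∈ p₂∈ y∈p₁ y∈p₂)) t∈p₂) Rt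

      unique₁₂ : Unique (concat (p₁ ∷ p₂ ∷ []))
      unique₁₂ = Unique.concat⁺ (proj₂ (All.lookup paths p₁∈) ∷ proj₂ (All.lookup paths p₂∈) ∷ [])
                                ((disjoint₁₂ ∷ []) ∷ [] ∷ [])

      covered₁₂ : ∀ v → v ∈ concat (p₁ ∷ p₂ ∷ [])
      covered₁₂ v with ∈-concat⁻′ ps (covered v)
      ... | p , v∈p , p∈ with counts p∈
      ...   | inj₁ (c , _) = let w , w∈p , Sw = count≡suc⇒∃ S c
                                 p≡p₁ = same-path p∈ p₁∈ (subst (_∈ p) (Equivalence.to (S≡s w) Sw) w∈p) s∈p₁
                             in ∈-++⁺ˡ (subst (v ∈_) p≡p₁ v∈p)
      ...   | inj₂ (_ , c) = let w , w∈p , Rw = count≡suc⇒∃ R c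
                                 p≡p₂ = same-path p∈ p₂∈ (subst (_∈ p) (Equivalence.to (R≡t w) Rw) w∈p) t∈p₂
                             in ∈-++⁺ʳ p₁ (∈-++⁺ˡ (subst (v ∈_) p≡p₂ v∈p))

module _ {m n : ℕ} {D′ : Digraph m} {D : Digraph n} {e : Fin m → Fin n}
         (e-injective : ∀ {u v} → e u ≡ e v → u ≡ v)
         (e-arc : ∀ {u v} → Arc D′ u v → Arc D (e u) (e v)) where

  map-walk : ∀ {p} → Walk D′ p → Walk D (map e p)
  map-walk (single v) = single (e v)
  map-walk (step u→v walk) = step (e-arc u→v) (map-walk walk)

  map-path : ∀ {p} → IsPath D′ p → IsPath D (map e p)
  map-path (walk , unique) = map-walk walk , Unique.map⁺ e-injective unique

  ∉-map : ∀ {x} → (∀ u → e u ≢ x) → ∀ xs → x ∉ map e xs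
  ∉-map e≢x xs x∈ = let u , _ , x≡eu = ∈-map⁻ e x∈ in e≢x u (sym x≡eu)

  insert-into-map-path : ∀ {x p} → IsPath D′ p → (∀ u → e u ≢ x) → (∀ {u} → u ∈ p → Adjacent D x (e u))
    → Σ (List (Fin n)) λ q → IsPath D q × q ↭ x ∷ map e p
  insert-into-map-path {p = p} path e≢x adjacent = insert-path D (map-path path) (∉-map e≢x p)
    λ y∈ → let u , u∈p , y≡eu = ∈-map⁻ e y∈ in subst (Adjacent D _) (sym y≡eu) (adjacent u∈p)

  extend-two-path-partition : ∀ {p₁ p₂ a b} → IsPathPartition D′ (p₁ ∷ p₂ ∷ [])
    → a ≢ b → (∀ u → e u ≢ a) → (∀ u → e u ≢ b) → (∀ v → v ≡ a ⊎ v ≡ b ⊎ ∃ λ u → v ≡ e u)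
    → (∀ {u} → u ∈ p₁ → Adjacent D a (e u)) → (∀ {u} → u ∈ p₂ → Adjacent D b (e u))
    → Σ (List (Fin n)) λ q₁ → Σ (List (Fin n)) λ q₂ → IsPathPartition D (q₁ ∷ q₂ ∷ [])
        × q₁ ↭ a ∷ map e p₁ × q₂ ↭ b ∷ map e p₂
  extend-two-path-partition {p₁} {p₂} {a} {b} (path₁ ∷ path₂ ∷ [] , unique , covered)
                            a≢b e≢a e≢b vertices adjacent₁ adjacent₂
    with insert-into-map-path path₁ e≢a adjacent₁ | insert-into-map-path path₂ e≢b adjacent₂
  ... | q₁ , q-path₁ , q₁↭ | q₂ , q-path₂ , q₂↭ =
    q₁ , q₂ , (q-path₁ ∷ q-path₂ ∷ [] , unique′ , covered′) , q₁↭ , q₂↭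
    where
      old : List (Fin m)
      old = concat (p₁ ∷ p₂ ∷ [])

      q₁q₂↭ : concat (q₁ ∷ q₂ ∷ []) ↭ a ∷ b ∷ map e old
      q₁q₂↭ = begin
        q₁ ++ q₂ ++ []                              ↭⟨ ++⁺ q₁↭ (++⁺ʳ [] q₂↭) ⟩
        (a ∷ map e p₁) ++ (b ∷ map e p₂) ++ []      ↭⟨ prep a (shift b (map e p₁) (map e p₂ ++ [])) ⟩
        a ∷ b ∷ map e p₁ ++ map e p₂ ++ []          ≡⟨ cong (λ xs → a ∷ b ∷ xs) (concat-map (p₁ ∷ p₂ ∷ [])) ⟩
        a ∷ b ∷ map e old                            ∎
        where open PermutationReasoning

      unique′ : Unique (concat (q₁ ∷ q₂ ∷ []))
      unique′ = ↭-Unique (↭-sym q₁q₂↭)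
        ((a≢b ∷ ¬Any⇒All¬ _ (∉-map e≢a old)) ∷ ¬Any⇒All¬ _ (∉-map e≢b old) ∷ Unique.map⁺ e-injective unique)

      covered′ : ∀ v → v ∈ concat (q₁ ∷ q₂ ∷ [])
      covered′ v = ∈-resp-↭ (↭-sym q₁q₂↭) (new-or-old (vertices v))
        where
          new-or-old : v ≡ a ⊎ v ≡ b ⊎ (∃ λ u → v ≡ e u) → v ∈ a ∷ b ∷ map e old
          new-or-old (inj₁ refl) = here refl
          new-or-old (inj₂ (inj₁ refl)) = there (here refl)
          new-or-old (inj₂ (inj₂ (u , refl))) = there (there (∈-map⁺ e (covered u)))

complementCycle-far : ∀ {n} (x y : Fin n) → suc (toℕ y) < toℕ x → (suc (toℕ x) ≡ n → toℕ y ≢ 0)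
  → ComplementCycle n x y
complementCycle-far {n} x y gap no-wrap = x≢y , ¬adjacent
  where
    y<x : toℕ y < toℕ x
    y<x = <-trans (n<1+n _) gap

    x≢y : x ≢ y
    x≢y x≡y = <⇒≢ y<x (sym (cong toℕ x≡y))

    ¬adjacent : ¬ CycleAdj n x y
    ¬adjacent (inj₁ 1+x≡y) = <-asym y<x (subst (toℕ x <_) 1+x≡y (n<1+n _))
    ¬adjacent (inj₂ (inj₁ 1+y≡x)) = <⇒≢ gap 1+y≡x
    ¬adjacent (inj₂ (inj₂ (inj₁ (1+x≡n , y≡0)))) = no-wrap 1+x≡n y≡0
    ¬adjacent (inj₂ (inj₂ (inj₂ (_ , x≡0)))) = n≮0 (subst (suc (toℕ y) <_) x≡0 gap)

reduce-arc : ∀ k (D : Digraph (2 * k + 1)) {u v} → Arc (reduce k D) u v → Arc D (emb k u) (emb k v)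
reduce-arc k D = proj₁ ∘ Equivalence.to T-∧

2*k≡2+2*[k∸1] : ∀ k → 1 ≤ k → 2 * k ≡ 2 + 2 * (k ∸ 1)
2*k≡2+2*[k∸1] (suc j) _ = *-suc 2 j

2*[k∸1]≢0 : ∀ k → 3 ≤ k → 2 * (k ∸ 1) ≢ 0
2*[k∸1]≢0 (suc (suc (suc j))) _ ()
2*[k∸1]≢0 (suc zero) (s≤s ())

<3+m⇒≤m⊎≡1+m⊎≡2+m : ∀ {i m} → i < 3 + m → i ≤ m ⊎ i ≡ 1 + m ⊎ i ≡ 2 + m
<3+m⇒≤m⊎≡1+m⊎≡2+m i<3+m with m<1+n⇒m<n∨m≡n i<3+m
... | inj₂ i≡2+m = inj₂ (inj₂ i≡2+m)
... | inj₁ i<2+m with m<1+n⇒m<n∨m≡n i<2+m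
...   | inj₂ i≡1+m = inj₂ (inj₁ i≡1+m)
...   | inj₁ i<1+m = inj₁ (m<1+n⇒m≤n i<1+m)

-- With m = 2k − 2, the deleted vertices x_{2k−1} and x_{2k} are a and b.
module Labels (k : ℕ) (k≥3 : 3 ≤ k) where

  m : ℕ
  m = 2 * (k ∸ 1)

  2k≡2+m : 2 * k ≡ 2 + m
  2k≡2+m = 2*k≡2+2*[k∸1] k (≤-trans (s≤s z≤n) k≥3)

  n≡3+m : 2 * k + 1 ≡ 3 + m
  n≡3+m = trans (cong (_+ 1) 2k≡2+m) (+-comm (2 + m) 1)

  ≤m⇒<m+1 : ∀ {i} → i ≤ m → i < m + 1
  ≤m⇒<m+1 {i} i≤m = subst (i <_) (+-comm 1 m) (s≤s i≤m)

  toℕ≤m : (u : Fin (m + 1)) → toℕ u ≤ m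
  toℕ≤m u = m<1+n⇒m≤n (subst (toℕ u <_) (+-comm m 1) (toℕ<n u))

  x₀ xₘ : Fin (m + 1)
  x₀ = fromℕ< (≤m⇒<m+1 z≤n)
  xₘ = fromℕ< (≤m⇒<m+1 ≤-refl)

  toℕ-x₀ : toℕ x₀ ≡ 0
  toℕ-x₀ = toℕ-fromℕ< _

  toℕ-xₘ : toℕ xₘ ≡ m
  toℕ-xₘ = toℕ-fromℕ< _

  x₀≢xₘ : x₀ ≢ xₘ
  x₀≢xₘ x₀≡xₘ = 2*[k∸1]≢0 k k≥3 (trans (sym toℕ-xₘ) (trans (cong toℕ (sym x₀≡xₘ)) toℕ-x₀))

  a b : Fin (2 * k + 1)
  a = fromℕ< (subst (1 + m <_) (sym n≡3+m) (m<n⇒m<1+n (n<1+n (1 + m))))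
  b = fromℕ< (subst (2 + m <_) (sym n≡3+m) (n<1+n (2 + m)))

  toℕ-a : toℕ a ≡ 1 + m
  toℕ-a = toℕ-fromℕ< _

  toℕ-b : toℕ b ≡ 2 + m
  toℕ-b = toℕ-fromℕ< _

  toℕ-emb : ∀ u → toℕ (emb k u) ≡ toℕ u
  toℕ-emb u = toℕ-inject≤ u (small≤big k)

  emb-injective : ∀ {u v} → emb k u ≡ emb k v → u ≡ v
  emb-injective = inject≤-injective _ _ _ _

  toℕ-emb≤m : ∀ u → toℕ (emb k u) ≤ m
  toℕ-emb≤m u = subst (_≤ m) (sym (toℕ-emb u)) (toℕ≤m u)

  a≢b : a ≢ b
  a≢b a≡b = <⇒≢ (n<1+n (1 + m)) (trans (sym toℕ-a) (trans (cong toℕ a≡b) toℕ-b))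

  emb≢a : ∀ u → emb k u ≢ a
  emb≢a u eu≡a = 1+n≰n (subst (_≤ m) (trans (cong toℕ eu≡a) toℕ-a) (toℕ-emb≤m u))

  emb≢b : ∀ u → emb k u ≢ b
  emb≢b u eu≡b = 1+n≰n (≤-trans (n≤1+n _) (subst (_≤ m) (trans (cong toℕ eu≡b) toℕ-b) (toℕ-emb≤m u)))

  vertices : ∀ v → v ≡ a ⊎ v ≡ b ⊎ ∃ λ u → v ≡ emb k u
  vertices v with <3+m⇒≤m⊎≡1+m⊎≡2+m (subst (toℕ v <_) n≡3+m (toℕ<n v))
  ... | inj₂ (inj₁ v≡1+m) = inj₁ (toℕ-injective (trans v≡1+m (sym toℕ-a)))
  ... | inj₂ (inj₂ v≡2+m) = inj₂ (inj₁ (toℕ-injective (trans v≡2+m (sym toℕ-b))))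
  ... | inj₁ v≤m = inj₂ (inj₂ (u , toℕ-injective (sym (trans (toℕ-emb u) (toℕ-fromℕ< _)))))
    where
      u : Fin (m + 1)
      u = fromℕ< (≤m⇒<m+1 v≤m)

  adjacent-a : ∀ {D} → IsSuperOrientation (ComplementCycle (2 * k + 1)) D
    → ∀ {u} → ¬ T (toℕ u ≡ᵇ m) → Adjacent D a (emb k u)
  adjacent-a (_ , edges) {u} u≢m = edges a (emb k u) (complementCycle-far a (emb k u) gap no-wrap)
    where
      gap : suc (toℕ (emb k u)) < toℕ a
      gap = subst₂ (λ i j → suc i < j) (sym (toℕ-emb u)) (sym toℕ-a)
                   (s≤s (≤∧≢⇒< (toℕ≤m u) (u≢m ∘ ≡⇒≡ᵇ (toℕ u) m)))
      no-wrap : suc (toℕ a) ≡ 2 * k + 1 → toℕ (emb k u) ≢ 0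
      no-wrap 1+a≡n _ = <⇒≢ (n<1+n (2 + m)) (trans (cong suc (sym toℕ-a)) (trans 1+a≡n n≡3+m))

  adjacent-b : ∀ {D} → IsSuperOrientation (ComplementCycle (2 * k + 1)) D
    → ∀ {u} → ¬ T (toℕ u ≡ᵇ 0) → Adjacent D b (emb k u)
  adjacent-b (_ , edges) {u} u≢0 = edges b (emb k u) (complementCycle-far b (emb k u) gap no-wrap)
    where
      gap : suc (toℕ (emb k u)) < toℕ b
      gap = subst (suc (toℕ (emb k u)) <_) (sym toℕ-b) (s≤s (s≤s (toℕ-emb≤m u)))
      no-wrap : suc (toℕ b) ≡ 2 * k + 1 → toℕ (emb k u) ≢ 0
      no-wrap _ eu≡0 = u≢0 (≡⇒≡ᵇ (toℕ u) 0 (trans (sym (toℕ-emb u)) eu≡0))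

  pairSet-emb : ∀ u → pairSet 0 (2 * k) (emb k u) ≡ (toℕ u ≡ᵇ 0)
  pairSet-emb u = trans (cong₂ _∨_ (cong (_≡ᵇ 0) (toℕ-emb u)) (≢⇒≡ᵇ≡false eu≢2k)) (∨-identityʳ _)
    where
      eu≢2k : toℕ (emb k u) ≢ 2 * k
      eu≢2k eu≡2k = 1+n≰n (≤-trans (n≤1+n _) (subst (_≤ m) (trans eu≡2k 2k≡2+m) (toℕ-emb≤m u)))

  pairSet-a : pairSet 0 (2 * k) a ≡ false
  pairSet-a = cong₂ _∨_ (≢⇒≡ᵇ≡false (λ a≡0 → 1+n≢0 (trans (sym toℕ-a) a≡0)))
                        (≢⇒≡ᵇ≡false (λ a≡2k → <⇒≢ (n<1+n (1 + m)) (trans (sym toℕ-a) (trans a≡2k 2k≡2+m))))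

  pairSet-b : T (pairSet 0 (2 * k) b)
  pairSet-b = Equivalence.from T-∨ (inj₂ (≡⇒≡ᵇ (toℕ b) (2 * k) (trans toℕ-b (sym 2k≡2+m))))

  count-with-a : ∀ {p q} → q ↭ a ∷ map (emb k) p → count (pairSet 0 (2 * k)) q ≡ count (λ u → toℕ u ≡ᵇ 0) p
  count-with-a {p} {q} q↭ = begin
    count (pairSet 0 (2 * k)) q                   ≡⟨ count-↭ (pairSet 0 (2 * k)) q↭ ⟩
    count (pairSet 0 (2 * k)) (a ∷ map (emb k) p) ≡⟨ count-∷-∉ (pairSet 0 (2 * k)) {a} {map (emb k) p} (subst T pairSet-a) ⟩
    count (pairSet 0 (2 * k)) (map (emb k) p)     ≡⟨ count-map (emb k) pairSet-emb p ⟩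
    count (λ u → toℕ u ≡ᵇ 0) p                    ∎
    where open ≡-Reasoning

  count-with-b : ∀ {p q} → q ↭ b ∷ map (emb k) p → count (pairSet 0 (2 * k)) q ≡ suc (count (λ u → toℕ u ≡ᵇ 0) p)
  count-with-b {p} {q} q↭ = begin
    count (pairSet 0 (2 * k)) q                   ≡⟨ count-↭ (pairSet 0 (2 * k)) q↭ ⟩
    count (pairSet 0 (2 * k)) (b ∷ map (emb k) p) ≡⟨ count-∷-∈ (pairSet 0 (2 * k)) {b} {map (emb k) p} pairSet-b ⟩
    suc (count (pairSet 0 (2 * k)) (map (emb k) p)) ≡⟨ cong suc (count-map (emb k) pairSet-emb p) ⟩
    suc (count (λ u → toℕ u ≡ᵇ 0) p)              ∎
    where open ≡-Reasoning

lemma2 : (k : ℕ) → 3 ≤ k → (D : Digraph (2 * k + 1))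
    → IsSuperOrientation (ComplementCycle (2 * k + 1)) D
    → Σ (List (List (Fin (2 * (k ∸ 1) + 1)))) (λ ps → IsPathPartition (reduce k D) ps × Orthogonal (pairSet 0 (2 * (k ∸ 1))) ps)
    → Σ (List (List (Fin (2 * k + 1)))) (λ ps → IsPathPartition D ps × Orthogonal (pairSet 0 (2 * k)) ps)
lemma2 k k≥3 D D-orients (ps , partition , orthogonal) =
  let p₁ , p₂ , partition₂ , (x₀-once-in-p₁ , xₘ-not-in-p₁) , (x₀-not-in-p₂ , _) =
        two-path-partition (≡ᵇ-indicates toℕ-x₀) (≡ᵇ-indicates toℕ-xₘ) x₀≢xₘ partition orthogonal
      q₁ , q₂ , partition′ , q₁↭ , q₂↭ =
        extend-two-path-partition emb-injective (reduce-arc k D) partition₂ a≢b emb≢a emb≢b vertices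
          (adjacent-a D-orients ∘ count≡0⇒¬T _ xₘ-not-in-p₁)
          (adjacent-b D-orients ∘ count≡0⇒¬T _ x₀-not-in-p₂)
  in q₁ ∷ q₂ ∷ [] , partition′ ,
     trans (count-with-a q₁↭) x₀-once-in-p₁ ∷ trans (count-with-b q₂↭) (cong suc x₀-not-in-p₂) ∷ []
  where open Labels k k≥3
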